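{- Let $q$ be a prime power, $D\ge3$, $e\in\{0,1,2\}$ or $e\in\{1/2,3/2\}$ with $q$ a square, and $\kappa=q^{ -e/2}$, $\kappa'=\sqrt{ -1}\,q^{ -D/2}$. With the matrices $\mathfrak t,\mathfrak t',\mathfrak u,\mathfrak u',\mathfrak x$ of the context, there is a representation $\overline{\mathcal H}(\kappa,\kappa')\to\operatorname{Mat}_{2D}(\mathbb C)$ such that $\mathcal T\mapsto\mathfrak t$, $\mathcal T'\mapsto\mathfrak t'$, $\mathcal U\mapsto\mathfrak u$, $\mathcal U'\mapsto\mathfrak u'$, $\mathcal X\mapsto\mathfrak x$.
   Context: For nonzero $\kappa,\kappa'\in\mathbb C$, $\overline{\mathcal H}(\kappa,\kappa')$ is the $\mathbb C$-algebra generated by $\mathcal T^{\pm1},\mathcal U,\mathcal X^{\pm1}$ (with $\mathcal T^{\pm1}$ mutually inverse and $\mathcal X^{\pm1}$ mutually inverse) subject to $(\mathcal T-\kappa)(\mathcal T+\kappa^{ -1})=0$, $(\mathcal T'-\kappa')(\mathcal T'+\kappa'^{ -1})=0$, $\mathcal U(\mathcal U+1)=0$, $\mathcal U'^2=0$, where $\mathcal T'=\mathcal X\mathcal T^{ -1}$ and $\mathcal U'=\mathcal X^{ -1}(\mathcal U+1)$ (a nil-DAHA of type $(C_1^\vee,C_1)$). Define $t(i)=\begin{pmatrix}q^{ -e/2}-q^{e/2}&q^{e/2}\\ q^{ -e/2}&0\end{pmatrix}$, $u'(i)=\begin{pmatrix}0&0\\-\sqrt{ -1}\,q^{(D-e)/2-i}&0\end{pmatrix}$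 for $0\le i\le D-1$; $t'(i)=\sqrt{ -1}\begin{pmatrix}q^{ -D/2}(q^D-q^i+1)&q^{D/2}(q^{i-D}-1)\\ q^{ -D/2}(1-q^i)&q^{i-D/2}\end{pmatrix}$, $u(i)=\begin{pmatrix}-1&1-q^{D-i}\\0&0\end{pmatrix}$ for $1\le i\le D-1$; $t'(0)=t'(D)=(\sqrt{ -1}\,q^{ -D/2})$, $u(0)=(0)$, $u(D)=(-1)$. Let $\mathfrak t=\operatorname{blockdiag}(t(0),\dots,t(D-1))$, $\mathfrak t'=\operatorname{blockdiag}(t'(0),t'(1),\dots,t'(D-1),t'(D))$, $\mathfrak u=\operatorname{blockdiag}(u(0),\dots,u(D))$, $\mathfrak u'=\operatorname{blockdiag}(u'(0),\dots,u'(D-1))$ (all $2D\times2D$), and $\mathfrak x=\mathfrak t'\mathfrak t$. -}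

module Defs where

open import Level using (Level)
open import Data.Nat as ℕ using (ℕ; zero; suc; _≡ᵇ_)
open import Data.Nat.DivMod using (_/_; _%_)
open import Data.Integer as ℤ using (ℤ; +_; -[1+_])
open import Data.Fin using (Fin; toℕ) renaming (zero to fzero; suc to fsuc)
open import Data.Bool using (if_then_else_; _∧_)
open import Algebra.Bundles using (CommutativeRing)

-- Everything is parametrised by a commutative ring K (standing in for ℂ),
-- an element i with i * i ≈ - 1 (a square root of -1), and a unit ρ with
-- inverse ρ⁻¹.  Later ρ will be required to satisfy ρ⁴ ≈ q, so that
-- qq z := ρ^z plays the role of q^(z/4).
module Setup {c ℓ : Level} (K : CommutativeRing c ℓ)
             (i ρ ρ⁻¹ : CommutativeRing.Carrier K) where
  open CommutativeRing K

  pow : Carrier → ℕ → Carrier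
  pow x zero = 1#
  pow x (suc n) = x * pow x n

  natK : ℕ → Carrier
  natK zero = 0#
  natK (suc n) = 1# + natK n

  qq : ℤ → Carrier
  qq (+ n) = pow ρ n
  qq -[1+ n ] = pow ρ⁻¹ (suc n)

  _-ᵣ_ : Carrier → Carrier → Carrier
  x -ᵣ y = x + (- y)

  z : ℕ → ℤ
  z n = + n

  Mat : ℕ → Set c
  Mat n = Fin n → Fin n → Carrier

  sumFin : (n : ℕ) → (Fin n → Carrier) → Carrier
  sumFin zero f = 0#
  sumFin (suc n) f = f fzero + sumFin n (λ k → f (fsuc k))

  _⊗_ : {n : ℕ} → Mat n → Mat n → Mat n
  _⊗_ {n} A B a b = sumFin n (λ k → A a k * B k b)

  _⊕_ : {n : ℕ} → Mat n → Mat n → Mat n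
  (A ⊕ B) a b = A a b + B a b

  _⊝_ : {n : ℕ} → Mat n → Mat n → Mat n
  (A ⊝ B) a b = A a b -ᵣ B a b

  idM : {n : ℕ} → Mat n
  idM a b = if toℕ a ≡ᵇ toℕ b then 1# else 0#

  zeroM : {n : ℕ} → Mat n
  zeroM a b = 0#

  scal : {n : ℕ} → Carrier → Mat n
  scal x a b = if toℕ a ≡ᵇ toℕ b then x else 0#

  _≋_ : {n : ℕ} → Mat n → Mat n → Set ℓ
  A ≋ B = ∀ a b → A a b ≈ B a b

  blk : Carrier → Carrier → Carrier → Carrier → ℕ → ℕ → Carrier
  blk c00 c01 c10 c11 zero zero = c00
  blk c00 c01 c10 c11 zero (suc _) = c01
  blk c00 c01 c10 c11 (suc _) zero = c10
  blk c00 c01 c10 c11 (suc _) (suc _) = c11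

  -- the 2×2 blocks of the context (k is the block index i of the paper,
  -- E = 2e, D as in the paper); written with qq, i.e. q^(w) = qq (4w)
  t-blk : ℕ → ℕ → ℕ → ℕ → ℕ → Carrier
  t-blk D E k = blk (qq (ℤ.- z E) -ᵣ qq (z E)) (qq (z E)) (qq (ℤ.- z E)) 0#

  u'-blk : ℕ → ℕ → ℕ → ℕ → ℕ → Carrier
  u'-blk D E k = blk 0# 0# (- (i * qq ((z (2 ℕ.* D) ℤ.- z E) ℤ.- z (4 ℕ.* k)))) 0#

  t'-blk : ℕ → ℕ → ℕ → ℕ → Carrier
  t'-blk D k = blk
    (i * (qq (ℤ.- z (2 ℕ.* D)) * ((qq (z (4 ℕ.* D)) -ᵣ qq (z (4 ℕ.* k))) + 1#)))
    (i * (qq (z (2 ℕ.* D)) * (qq (z (4 ℕ.* k) ℤ.- z (4 ℕ.* D)) -ᵣ 1#)))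
    (i * (qq (ℤ.- z (2 ℕ.* D)) * (1# -ᵣ qq (z (4 ℕ.* k)))))
    (i * qq (z (4 ℕ.* k) ℤ.- z (2 ℕ.* D)))

  u-blk : ℕ → ℕ → ℕ → ℕ → Carrier
  u-blk D k = blk (- 1#) (1# -ᵣ qq (z (4 ℕ.* D) ℤ.- z (4 ℕ.* k))) 0# 0#

  diag2 : (ℕ → ℕ → ℕ → Carrier) → ℕ → ℕ → Carrier
  diag2 B a b = if (a / 2) ≡ᵇ (b / 2) then B (a / 2) (a % 2) (b % 2) else 0#

  -- block-diagonal with a 1×1 block at 0, 2×2 blocks at rows 2k-1, 2k
  -- (k = 1..D-1), and a 1×1 block at 2D-1 (entries of the 1×1 blocks:
  -- first for block 0, second for block D)
  diag121 : ℕ → Carrier → Carrier → (ℕ → ℕ → ℕ → Carrier) → ℕ → ℕ → Carrier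
  diag121 D x0 xD B a b =
    if (suc a / 2) ≡ᵇ (suc b / 2)
    then (if (suc a / 2) ≡ᵇ 0 then x0
          else if (suc a / 2) ≡ᵇ D then xD
          else B (suc a / 2) (suc a % 2) (suc b % 2))
    else 0#

  toMat : (D : ℕ) → (ℕ → ℕ → Carrier) → Mat (2 ℕ.* D)
  toMat D f a b = f (toℕ a) (toℕ b)

  𝔱 : (D E : ℕ) → Mat (2 ℕ.* D)
  𝔱 D E = toMat D (diag2 (t-blk D E))

  𝔲' : (D E : ℕ) → Mat (2 ℕ.* D)
  𝔲' D E = toMat D (diag2 (u'-blk D E))

  𝔱' : (D : ℕ) → Mat (2 ℕ.* D)
  𝔱' D = toMat D (diag121 D (i * qq (ℤ.- z (2 ℕ.* D))) (i * qq (ℤ.- z (2 ℕ.* D))) (t'-blk D))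

  𝔲 : (D : ℕ) → Mat (2 ℕ.* D)
  𝔲 D = toMat D (diag121 D 0# (- 1#) (u-blk D))

  𝔵 : (D E : ℕ) → Mat (2 ℕ.* D)
  𝔵 D E = 𝔱' D ⊗ 𝔱 D E

  -- κ = q^(-e/2), κ' = √-1 q^(-D/2), and their inverses
  κ κ⁻¹ : ℕ → Carrier
  κ E = qq (ℤ.- z E)
  κ⁻¹ E = qq (z E)
  κ' κ'⁻¹ : ℕ → Carrier
  κ' D = i * qq (ℤ.- z (2 ℕ.* D))
  κ'⁻¹ D = - (i * qq (z (2 ℕ.* D)))

  -- A representation of H̄(κ,κ') (given by generators and relations) on
  -- K^(2D) with T ↦ t, T' ↦ t', U ↦ u, U' ↦ u', X ↦ x: by the universal
  -- property of the presentation, this is exactly: t and x are invertible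
  -- (images of T^{-1}, X^{-1}), the images of T' = X T^{-1} and
  -- U' = X^{-1}(U+1) are t' and u', and the four defining relations hold.
  record IsRep (n : ℕ) (κ₀ κ₀⁻¹ κ₁ κ₁⁻¹ : Carrier) (t t' u u' x : Mat n) : Set (c Level.⊔ ℓ) where
    field
      tinv xinv : Mat n
      t-tinv : (t ⊗ tinv) ≋ idM
      tinv-t : (tinv ⊗ t) ≋ idM
      x-xinv : (x ⊗ xinv) ≋ idM
      xinv-x : (xinv ⊗ x) ≋ idM
      T'↦t' : t' ≋ (x ⊗ tinv)
      U'↦u' : u' ≋ (xinv ⊗ (u ⊕ idM))
      rel-T : ((t ⊝ scal κ₀) ⊗ (t ⊕ scal κ₀⁻¹)) ≋ zeroM
      rel-T' : ((t' ⊝ scal κ₁) ⊗ (t' ⊕ scal κ₁⁻¹)) ≋ zeroM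
      rel-U : (u ⊗ (u ⊕ idM)) ≋ zeroM
      rel-U' : (u' ⊗ u') ≋ zeroM

-- The five matrices are block diagonal with 2 × 2 blocks: 𝔱 and 𝔲' for the
-- pairing {2k, 2k+1} of indices, 𝔱' and 𝔲 for the pairing {2k-1, 2k}, whose first
-- and last blocks are cut down to 1 × 1.  Every defining relation of H̄ has the form
-- (A - α)(A + β) = 0, and it holds blockwise by Cayley–Hamilton because every block
-- has trace α - β and determinant -αβ; when αβ = 1 the same identity shows that
-- A - α + β inverts A.  The one relation coupling the two pairings, 𝔵 𝔲' = 𝔲 + 1
-- with 𝔵 = 𝔱' 𝔱, holds because 𝔱 𝔲' is diagonal, hence block diagonal for the
-- second pairing too.  All identities hold for every unit ρ and every square root i
-- of -1.

module Submission where

open import Defs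
open import Level using (Level; _⊔_)
open import Algebra.Bundles using (CommutativeRing)
open import Data.Nat as ℕ using (ℕ; zero; suc; _≡ᵇ_)
open import Data.Nat.DivMod using (_/_; _%_)
open import Data.Fin as Fin using (Fin; toℕ)
open import Data.Bool using (true; false; if_then_else_)
open import Relation.Binary.PropositionalEquality as ≡ using (_≡_)
open import Relation.Binary.Bundles using (Setoid)
import Relation.Binary.Reasoning.Setoid as Reasoning

module Halves where
  open import Data.Nat
  open import Data.Nat.Properties
  open import Data.Nat.DivMod
  open import Relation.Nullary using (contradiction)
  open ≡ using (refl; trans; subst)

  data ParityView : ℕ → Set where
    even : ∀ m → ParityView (m * 2)
    odd  : ∀ m → ParityView (suc (m * 2))

  nextParity : ∀ {n} → ParityView n → ParityView (suc n)
  nextParity (even m) = odd m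
  nextParity (odd m) = even (suc m)

  parityView : ∀ n → ParityView n
  parityView zero = even 0
  parityView (suc n) = nextParity (parityView n)

  m*2/2≡m : ∀ m → m * 2 / 2 ≡ m
  m*2/2≡m m = m*n/n≡m m 2

  m*2%2≡0 : ∀ m → m * 2 % 2 ≡ 0
  m*2%2≡0 m = m*n%n≡0 m 2

  [1+m*2]/2≡m : ∀ m → suc (m * 2) / 2 ≡ m
  [1+m*2]/2≡m m = trans (+-distrib-/ 1 (m * 2) 1+0<2) (m*2/2≡m m)
    where
    1+0<2 : 1 + m * 2 % 2 < 2
    1+0<2 = subst (λ r → 1 + r < 2) (≡.sym (m*2%2≡0 m)) (s≤s (s≤s z≤n))

  [1+m*2]%2≡1 : ∀ m → suc (m * 2) % 2 ≡ 1
  [1+m*2]%2≡1 m = [m+kn]%n≡m%n 1 m 2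

  block slot : ∀ {n} → ParityView n → ℕ
  block (even m) = m
  block (odd m) = m
  slot (even m) = 0
  slot (odd m) = 1

  /2≡block : ∀ {n} (p : ParityView n) → n / 2 ≡ block p
  /2≡block (even m) = m*2/2≡m m
  /2≡block (odd m) = [1+m*2]/2≡m m

  %2≡slot : ∀ {n} (p : ParityView n) → n % 2 ≡ slot p
  %2≡slot (even m) = m*2%2≡0 m
  %2≡slot (odd m) = [1+m*2]%2≡1 m

  [1+n]/2≡0⇒[1+n]%2≡1 : ∀ n → suc n / 2 ≡ 0 → suc n % 2 ≡ 1
  [1+n]/2≡0⇒[1+n]%2≡1 n with parityView n
  ... | even m = λ _ → [1+m*2]%2≡1 m
  ... | odd m = λ eq → contradiction (trans (≡.sym (m*2/2≡m (suc m))) eq) λ ()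

  n/2≡m⇒n%2≡0 : ∀ {n m} → n ≤ m * 2 → n / 2 ≡ m → n % 2 ≡ 0
  n/2≡m⇒n%2≡0 {n} n≤m*2 with parityView n
  ... | even k = λ _ → m*2%2≡0 k
  ... | odd k = λ eq →
    contradiction (subst (λ m → suc (k * 2) ≤ m * 2) (trans (≡.sym eq) ([1+m*2]/2≡m k)) n≤m*2) (n≮n (k * 2))

  ≡ᵇ-true⇒≡ : ∀ {m n} → (m ≡ᵇ n) ≡ true → m ≡ n
  ≡ᵇ-true⇒≡ {m} {n} eq = ≡ᵇ⇒≡ m n (subst T (≡.sym eq) _)
    where open import Data.Bool using (T)

  m*2≡ᵇn*2 : ∀ m n → (m * 2 ≡ᵇ n * 2) ≡ (m ≡ᵇ n)
  m*2≡ᵇn*2 zero zero = refl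
  m*2≡ᵇn*2 zero (suc n) = refl
  m*2≡ᵇn*2 (suc m) zero = refl
  m*2≡ᵇn*2 (suc m) (suc n) = m*2≡ᵇn*2 m n

  m*2≢ᵇ1+n*2 : ∀ m n → (m * 2 ≡ᵇ suc (n * 2)) ≡ false
  m*2≢ᵇ1+n*2 zero n = refl
  m*2≢ᵇ1+n*2 (suc m) zero = refl
  m*2≢ᵇ1+n*2 (suc m) (suc n) = m*2≢ᵇ1+n*2 m n

  1+m*2≢ᵇn*2 : ∀ m n → (suc (m * 2) ≡ᵇ n * 2) ≡ false
  1+m*2≢ᵇn*2 m zero = refl
  1+m*2≢ᵇn*2 zero (suc n) = refl
  1+m*2≢ᵇn*2 (suc m) (suc n) = 1+m*2≢ᵇn*2 m n

-- Algebra.Solver.Ring can only cancel terms whose coefficients it can compare, so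
-- the coefficients are integers, mapped into K.
module IntegerRingSolver {c ℓ : Level} (K : CommutativeRing c ℓ) where
  open import Data.Integer as ℤ using (ℤ; +_; -[1+_]; _⊖_; _◃_)
  import Data.Integer.Properties as ℤ
  import Data.Nat.Properties as ℕ
  import Data.Sign as Sign
  open import Data.Maybe using (Maybe; just; nothing)
  open import Relation.Nullary using (yes; no)
  import Algebra.Solver.Ring.AlmostCommutativeRing as ACR
  open CommutativeRing K
  open import Algebra.Properties.Semiring.Mult.TCOptimised semiring using (_×_; ×-homo-+; ×1-homo-*)
  open import Algebra.Properties.Ring ring using (-0#≈0#; -‿involutive; -‿distribˡ-*; -‿distribʳ-*; -‿+-comm)
  open import Algebra.Properties.CommutativeSemigroup +-commutativeSemigroup using (interchange)
  open import Relation.Binary.Reasoning.Setoid setoid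

  fromℤ : ℤ → Carrier
  fromℤ (+ n) = n × 1#
  fromℤ -[1+ n ] = - (suc n × 1#)

  private
    fromℤ-⊖ : ∀ m n → fromℤ (m ⊖ n) ≈ m × 1# + - (n × 1#)
    fromℤ-⊖ m zero = sym (trans (+-congˡ -0#≈0#) (+-identityʳ _))
    fromℤ-⊖ zero (suc n) = sym (+-identityˡ _)
    fromℤ-⊖ (suc m) (suc n) = begin
      fromℤ (suc m ⊖ suc n)                ≡⟨ ≡.cong fromℤ (ℤ.[1+m]⊖[1+n]≡m⊖n m n) ⟩
      fromℤ (m ⊖ n)                        ≈⟨ fromℤ-⊖ m n ⟩
      m × 1# + - (n × 1#)                  ≈⟨ +-identityˡ _ ⟨
      0# + (m × 1# + - (n × 1#))           ≈⟨ +-congʳ (-‿inverseʳ 1#) ⟨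
      (1# + - 1#) + (m × 1# + - (n × 1#))  ≈⟨ interchange 1# (- 1#) (m × 1#) (- (n × 1#)) ⟩
      (1# + m × 1#) + (- 1# + - (n × 1#))
        ≈⟨ +-cong (×-homo-+ 1# 1 m) (trans (-‿cong (×-homo-+ 1# 1 n)) (sym (-‿+-comm 1# _))) ⟨
      suc m × 1# + - (suc n × 1#)          ∎

    fromℤ-+ : ∀ x y → fromℤ (x ℤ.+ y) ≈ fromℤ x + fromℤ y
    fromℤ-+ (+ m) (+ n) = ×-homo-+ 1# m n
    fromℤ-+ (+ m) -[1+ n ] = fromℤ-⊖ m (suc n)
    fromℤ-+ -[1+ m ] (+ n) = trans (fromℤ-⊖ n (suc m)) (+-comm _ _)
    fromℤ-+ -[1+ m ] -[1+ n ] = begin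
      - (suc (suc (m ℕ.+ n)) × 1#)     ≡⟨ ≡.cong (λ k → - (suc k × 1#)) (ℕ.+-suc m n) ⟨
      - ((suc m ℕ.+ suc n) × 1#)       ≈⟨ -‿cong (×-homo-+ 1# (suc m) (suc n)) ⟩
      - (suc m × 1# + suc n × 1#)      ≈⟨ -‿+-comm _ _ ⟨
      - (suc m × 1#) + - (suc n × 1#)  ∎

    fromℤ-neg : ∀ x → fromℤ (ℤ.- x) ≈ - fromℤ x
    fromℤ-neg (+ zero) = sym -0#≈0#
    fromℤ-neg (+ suc n) = refl
    fromℤ-neg -[1+ n ] = sym (-‿involutive _)

    fromℤ-+◃ : ∀ n → fromℤ (Sign.+ ◃ n) ≈ n × 1#
    fromℤ-+◃ n = reflexive (≡.cong fromℤ (ℤ.+◃n≡+n n))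

    fromℤ--◃ : ∀ n → fromℤ (Sign.- ◃ n) ≈ - (n × 1#)
    fromℤ--◃ n = trans (reflexive (≡.cong fromℤ (ℤ.-◃n≡-n n))) (fromℤ-neg (+ n))

    fromℤ-* : ∀ x y → fromℤ (x ℤ.* y) ≈ fromℤ x * fromℤ y
    fromℤ-* (+ m) (+ n) = trans (fromℤ-+◃ (m ℕ.* n)) (×1-homo-* m n)
    fromℤ-* (+ m) -[1+ n ] =
      trans (fromℤ--◃ (m ℕ.* suc n)) (trans (-‿cong (×1-homo-* m (suc n))) (-‿distribʳ-* _ _))
    fromℤ-* -[1+ m ] (+ n) =
      trans (fromℤ--◃ (suc m ℕ.* n)) (trans (-‿cong (×1-homo-* (suc m) n)) (-‿distribˡ-* _ _))
    fromℤ-* -[1+ m ] -[1+ n ] = begin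
      fromℤ (Sign.+ ◃ suc m ℕ.* suc n)       ≈⟨ fromℤ-+◃ (suc m ℕ.* suc n) ⟩
      (suc m ℕ.* suc n) × 1#                 ≈⟨ ×1-homo-* (suc m) (suc n) ⟩
      (suc m × 1#) * (suc n × 1#)            ≈⟨ -‿involutive _ ⟨
      - - ((suc m × 1#) * (suc n × 1#))      ≈⟨ -‿cong (-‿distribˡ-* _ _) ⟩
      - (- (suc m × 1#) * (suc n × 1#))      ≈⟨ -‿distribʳ-* _ _ ⟩
      - (suc m × 1#) * - (suc n × 1#)        ∎

    fromℤ-homomorphism : ℤ.+-*-rawRing ACR.-Raw-AlmostCommutative⟶ ACR.fromCommutativeRing K
    fromℤ-homomorphism = record
      { ⟦_⟧ = fromℤ ; +-homo = fromℤ-+ ; *-homo = fromℤ-* ; -‿homo = fromℤ-neg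
      ; 0-homo = refl ; 1-homo = refl }

    fromℤ-≟ : ∀ x y → Maybe (fromℤ x ≈ fromℤ y)
    fromℤ-≟ x y with x ℤ.≟ y
    ... | yes x≡y = just (reflexive (≡.cong fromℤ x≡y))
    ... | no _ = nothing

  open import Algebra.Solver.Ring ℤ.+-*-rawRing (ACR.fromCommutativeRing K) fromℤ-homomorphism fromℤ-≟
    public using (Polynomial; solve; _:=_; _:+_; _:*_; _:-_; :-_; con)

  :0 :1 : ∀ {n} → Polynomial n
  :0 = con (+ 0)
  :1 = con (+ 1)

-- K's _-_ unfolds to x + - y like Defs' _-ᵣ_, and unlike the
-- latter it has a fixity declaration.
module _ {c ℓ : Level} (K : CommutativeRing c ℓ) (i ρ ρ⁻¹ : CommutativeRing.Carrier K) where
  open CommutativeRing K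
  open Setup K i ρ ρ⁻¹
  open import Data.Product using (_×_; _,_; proj₁; proj₂)
  module ≈-Reasoning = Reasoning setoid
  open import Algebra.Properties.Semiring.Sum semiring using (sum; sum-cong-≋; ∑-comm; *-distribˡ-sum; *-distribʳ-sum)
  open import Algebra.Properties.Ring ring using (-0#≈0#)
  open Halves

  sumℕ : ℕ → (ℕ → Carrier) → Carrier
  sumℕ zero f = 0#
  sumℕ (suc n) f = f 0 + sumℕ n (λ k → f (suc k))

  sumFin≡sumℕ : ∀ n f → sumFin n (λ k → f (toℕ k)) ≡ sumℕ n f
  sumFin≡sumℕ zero f = ≡.refl
  sumFin≡sumℕ (suc n) f = ≡.cong (f 0 +_) (sumFin≡sumℕ n (λ k → f (suc k)))

  sumFin≡sum : ∀ n f → sumFin n f ≡ sum f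
  sumFin≡sum zero f = ≡.refl
  sumFin≡sum (suc n) f = ≡.cong (f Fin.zero +_) (sumFin≡sum n (λ k → f (Fin.suc k)))

  sumℕ-zero : ∀ n → sumℕ n (λ _ → 0#) ≈ 0#
  sumℕ-zero zero = refl
  sumℕ-zero (suc n) = trans (+-identityˡ _) (sumℕ-zero n)

  sumℕ-cong : ∀ n {f g} → (∀ k → f k ≈ g k) → sumℕ n f ≈ sumℕ n g
  sumℕ-cong zero f≈g = refl
  sumℕ-cong (suc n) f≈g = +-cong (f≈g 0) (sumℕ-cong n (λ k → f≈g (suc k)))

  sumℕ-snoc : ∀ n f → sumℕ (suc n) f ≈ sumℕ n f + f n
  sumℕ-snoc zero f = trans (+-identityʳ _) (sym (+-identityˡ _))
  sumℕ-snoc (suc n) f = trans (+-congˡ (sumℕ-snoc n (λ k → f (suc k)))) (sym (+-assoc _ _ _))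

  sumℕ-pairs : ∀ n f → sumℕ (n ℕ.* 2) f ≈ sumℕ n (λ m → f (m ℕ.* 2) + f (suc (m ℕ.* 2)))
  sumℕ-pairs zero f = refl
  sumℕ-pairs (suc n) f = trans (sym (+-assoc _ _ _)) (+-congˡ (sumℕ-pairs n (λ k → f (suc (suc k)))))

  sumℕ-select : ∀ {n k} h → k ℕ.< n → sumℕ n (λ m → if k ≡ᵇ m then h m else 0#) ≈ h k
  sumℕ-select {suc n} {zero} h _ = trans (+-congˡ (sumℕ-zero n)) (+-identityʳ _)
  sumℕ-select {suc n} {suc k} h (ℕ.s≤s k<n) = trans (+-identityˡ _) (sumℕ-select (λ m → h (suc m)) k<n)

  ≋-refl : ∀ {n} {A : Mat n} → A ≋ A
  ≋-refl a b = refl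

  ≋-sym : ∀ {n} {A B : Mat n} → A ≋ B → B ≋ A
  ≋-sym A≋B a b = sym (A≋B a b)

  ≋-trans : ∀ {n} {A B C : Mat n} → A ≋ B → B ≋ C → A ≋ C
  ≋-trans A≋B B≋C a b = trans (A≋B a b) (B≋C a b)

  ≋-setoid : ℕ → Setoid c ℓ
  ≋-setoid n = record
    { Carrier = Mat n ; _≈_ = _≋_
    ; isEquivalence = record { refl = ≋-refl ; sym = ≋-sym ; trans = ≋-trans } }

  module ≋-Reasoning {n} = Reasoning (≋-setoid n)

  sumFin-cong : ∀ n {f g : Fin n → Carrier} → (∀ k → f k ≈ g k) → sumFin n f ≈ sumFin n g
  sumFin-cong zero f≈g = refl
  sumFin-cong (suc n) f≈g = +-cong (f≈g Fin.zero) (sumFin-cong n (λ k → f≈g (Fin.suc k)))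

  sumFin-zero : ∀ n {f : Fin n → Carrier} → (∀ k → f k ≈ 0#) → sumFin n f ≈ 0#
  sumFin-zero zero f≈0 = refl
  sumFin-zero (suc n) f≈0 = trans (+-cong (f≈0 _) (sumFin-zero n (λ k → f≈0 (Fin.suc k)))) (+-identityʳ 0#)

  ⊗-cong : ∀ {n} {A A' B B' : Mat n} → A ≋ A' → B ≋ B' → (A ⊗ B) ≋ (A' ⊗ B')
  ⊗-cong {n} A≋A' B≋B' a b = sumFin-cong n (λ k → *-cong (A≋A' a k) (B≋B' k b))

  ⊗-assoc : ∀ {n} (A B C : Mat n) → ((A ⊗ B) ⊗ C) ≋ (A ⊗ (B ⊗ C))
  ⊗-assoc {n} A B C a b = begin
    sumFin n (λ k → (A ⊗ B) a k * C k b)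
      ≡⟨ sumFin≡sum n _ ⟩
    sum (λ k → sumFin n (λ j → A a j * B j k) * C k b)
      ≈⟨ sum-cong-≋ (λ k → *-congʳ (reflexive (sumFin≡sum n (λ j → A a j * B j k)))) ⟩
    sum (λ k → sum (λ j → A a j * B j k) * C k b)
      ≈⟨ sum-cong-≋ (λ k → *-distribʳ-sum (C k b) (λ j → A a j * B j k)) ⟩
    sum (λ k → sum (λ j → A a j * B j k * C k b))
      ≈⟨ ∑-comm (λ k j → A a j * B j k * C k b) ⟩
    sum (λ j → sum (λ k → A a j * B j k * C k b))
      ≈⟨ sum-cong-≋ (λ j → sum-cong-≋ (λ k → *-assoc (A a j) (B j k) (C k b))) ⟩
    sum (λ j → sum (λ k → A a j * (B j k * C k b)))
      ≈⟨ sum-cong-≋ (λ j → *-distribˡ-sum (A a j) (λ k → B j k * C k b)) ⟨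
    sum (λ j → A a j * sum (λ k → B j k * C k b))
      ≈⟨ sum-cong-≋ (λ j → *-congˡ (reflexive (sumFin≡sum n (λ k → B j k * C k b)))) ⟨
    sum (λ j → A a j * (B ⊗ C) j b)
      ≡⟨ sumFin≡sum n _ ⟨
    sumFin n (λ j → A a j * (B ⊗ C) j b)
      ∎
    where open ≈-Reasoning

  ⊗-identityˡ : ∀ {n} (A : Mat n) → (idM ⊗ A) ≋ A
  ⊗-identityˡ {n} A a b = select n a (λ k → A k b)
    where
    select : ∀ n (a : Fin n) (g : Fin n → Carrier) → sumFin n (λ k → idM a k * g k) ≈ g a
    select (suc n) Fin.zero g = trans (+-cong (*-identityˡ _) (sumFin-zero n (λ k → zeroˡ _))) (+-identityʳ _)
    select (suc n) (Fin.suc a) g = trans (+-cong (zeroˡ _) (select n a (λ k → g (Fin.suc k)))) (+-identityˡ _)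

  ⊗-identityʳ : ∀ {n} (A : Mat n) → (A ⊗ idM) ≋ A
  ⊗-identityʳ {n} A a b = select n b (λ k → A a k)
    where
    select : ∀ n (b : Fin n) (g : Fin n → Carrier) → sumFin n (λ k → g k * idM k b) ≈ g b
    select (suc n) Fin.zero g = trans (+-cong (*-identityʳ _) (sumFin-zero n (λ k → zeroʳ _))) (+-identityʳ _)
    select (suc n) (Fin.suc b) g = trans (+-cong (zeroʳ _) (select n b (λ k → g (Fin.suc k)))) (+-identityˡ _)

  Inverses : ∀ {n} → Mat n → Mat n → Set ℓ
  Inverses A B = (A ⊗ B) ≋ idM × (B ⊗ A) ≋ idM

  ⊗-cancelʳ : ∀ {n} {A B B⁻¹ : Mat n} → (B ⊗ B⁻¹) ≋ idM → ((A ⊗ B) ⊗ B⁻¹) ≋ A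
  ⊗-cancelʳ {A = A} {B} {B⁻¹} BB⁻¹≋1 = begin
    (A ⊗ B) ⊗ B⁻¹  ≈⟨ ⊗-assoc A B B⁻¹ ⟩
    A ⊗ (B ⊗ B⁻¹)  ≈⟨ ⊗-cong ≋-refl BB⁻¹≋1 ⟩
    A ⊗ idM        ≈⟨ ⊗-identityʳ A ⟩
    A              ∎
    where open ≋-Reasoning

  ⊗-cancelˡ : ∀ {n} {A A⁻¹ B : Mat n} → (A⁻¹ ⊗ A) ≋ idM → (A⁻¹ ⊗ (A ⊗ B)) ≋ B
  ⊗-cancelˡ {A = A} {A⁻¹} {B} A⁻¹A≋1 = begin
    A⁻¹ ⊗ (A ⊗ B)  ≈⟨ ⊗-assoc A⁻¹ A B ⟨
    (A⁻¹ ⊗ A) ⊗ B  ≈⟨ ⊗-cong A⁻¹A≋1 ≋-refl ⟩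
    idM ⊗ B        ≈⟨ ⊗-identityˡ B ⟩
    B              ∎
    where open ≋-Reasoning

  ⊗-inverses : ∀ {n} {A A⁻¹ B B⁻¹ : Mat n} → Inverses A A⁻¹ → Inverses B B⁻¹ → Inverses (A ⊗ B) (B⁻¹ ⊗ A⁻¹)
  ⊗-inverses {A = A} {A⁻¹} {B} {B⁻¹} (AA⁻¹≋1 , A⁻¹A≋1) (BB⁻¹≋1 , B⁻¹B≋1) =
    ≋-trans (≋-sym (⊗-assoc (A ⊗ B) B⁻¹ A⁻¹)) (≋-trans (⊗-cong (⊗-cancelʳ BB⁻¹≋1) ≋-refl) AA⁻¹≋1) ,
    ≋-trans (⊗-assoc B⁻¹ A⁻¹ (A ⊗ B)) (≋-trans (⊗-cong ≋-refl (⊗-cancelˡ A⁻¹A≋1)) B⁻¹B≋1)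

  relations⇒isRep : ∀ {n κ₀ κ₀⁻¹ κ₁ κ₁⁻¹} {t t' u u' t⁻¹ t'⁻¹ : Mat n} →
    Inverses t t⁻¹ → Inverses t' t'⁻¹ → ((t' ⊗ t) ⊗ u') ≋ (u ⊕ idM) →
    ((t ⊝ scal κ₀) ⊗ (t ⊕ scal κ₀⁻¹)) ≋ zeroM → ((t' ⊝ scal κ₁) ⊗ (t' ⊕ scal κ₁⁻¹)) ≋ zeroM →
    (u ⊗ (u ⊕ idM)) ≋ zeroM → (u' ⊗ u') ≋ zeroM →
    IsRep n κ₀ κ₀⁻¹ κ₁ κ₁⁻¹ t t' u u' (t' ⊗ t)
  relations⇒isRep {t⁻¹ = t⁻¹} {t'⁻¹} t-inverse t'-inverse xu'≋u+1 rel-T rel-T' rel-U rel-U' = record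
    { tinv = t⁻¹ ; xinv = t⁻¹ ⊗ t'⁻¹
    ; t-tinv = proj₁ t-inverse ; tinv-t = proj₂ t-inverse
    ; x-xinv = proj₁ x-inverse ; xinv-x = proj₂ x-inverse
    ; T'↦t' = ≋-sym (⊗-cancelʳ (proj₁ t-inverse))
    ; U'↦u' = ≋-trans (≋-sym (⊗-cancelˡ (proj₂ x-inverse))) (⊗-cong ≋-refl xu'≋u+1)
    ; rel-T = rel-T ; rel-T' = rel-T' ; rel-U = rel-U ; rel-U' = rel-U' }
    where
    x-inverse = ⊗-inverses t'-inverse t-inverse

  record M₂ : Set c where
    constructor mat₂
    field m₀₀ m₀₁ m₁₀ m₁₁ : Carrier
  open M₂

  entry : M₂ → ℕ → ℕ → Carrier
  entry A = blk (m₀₀ A) (m₀₁ A) (m₁₀ A) (m₁₁ A)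

  fromBlk : (ℕ → ℕ → Carrier) → M₂
  fromBlk B = mat₂ (B 0 0) (B 0 1) (B 1 0) (B 1 1)

  infixl 7 _*₂_
  infixl 6 _+₂_ _-₂_
  infix 4 _≈₂_

  _*₂_ _+₂_ _-₂_ : M₂ → M₂ → M₂
  A *₂ B = mat₂ (m₀₀ A * m₀₀ B + m₀₁ A * m₁₀ B) (m₀₀ A * m₀₁ B + m₀₁ A * m₁₁ B)
                (m₁₀ A * m₀₀ B + m₁₁ A * m₁₀ B) (m₁₀ A * m₀₁ B + m₁₁ A * m₁₁ B)
  A +₂ B = mat₂ (m₀₀ A + m₀₀ B) (m₀₁ A + m₀₁ B) (m₁₀ A + m₁₀ B) (m₁₁ A + m₁₁ B)
  A -₂ B = mat₂ (m₀₀ A - m₀₀ B) (m₀₁ A - m₀₁ B) (m₁₀ A - m₁₀ B) (m₁₁ A - m₁₁ B)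

  scalar₂ corner₀₀ corner₁₁ : Carrier → M₂
  scalar₂ α = mat₂ α 0# 0# α
  corner₀₀ α = mat₂ α 0# 0# 0#
  corner₁₁ α = mat₂ 0# 0# 0# α

  0₂ 1₂ : M₂
  0₂ = scalar₂ 0#
  1₂ = scalar₂ 1#

  trace det : M₂ → Carrier
  trace A = m₀₀ A + m₁₁ A
  det A = m₀₀ A * m₁₁ A - m₀₁ A * m₁₀ A

  _≈₂_ : M₂ → M₂ → Set ℓ
  A ≈₂ B = m₀₀ A ≈ m₀₀ B × m₀₁ A ≈ m₀₁ B × m₁₀ A ≈ m₁₀ B × m₁₁ A ≈ m₁₁ B

  entry-times₂ : ∀ A B r s → entry A r 0 * entry B 0 s + entry A r 1 * entry B 1 s ≡ entry (A *₂ B) r s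
  entry-times₂ A B zero zero = ≡.refl
  entry-times₂ A B zero (suc s) = ≡.refl
  entry-times₂ A B (suc r) zero = ≡.refl
  entry-times₂ A B (suc r) (suc s) = ≡.refl

  entry-plus₂ : ∀ A B r s → entry A r s + entry B r s ≡ entry (A +₂ B) r s
  entry-plus₂ A B zero zero = ≡.refl
  entry-plus₂ A B zero (suc s) = ≡.refl
  entry-plus₂ A B (suc r) zero = ≡.refl
  entry-plus₂ A B (suc r) (suc s) = ≡.refl

  entry-minus₂ : ∀ A B r s → entry A r s - entry B r s ≡ entry (A -₂ B) r s
  entry-minus₂ A B zero zero = ≡.refl
  entry-minus₂ A B zero (suc s) = ≡.refl
  entry-minus₂ A B (suc r) zero = ≡.refl
  entry-minus₂ A B (suc r) (suc s) = ≡.refl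

  entry-cong : ∀ {A B} → A ≈₂ B → ∀ r s → entry A r s ≈ entry B r s
  entry-cong (p , _ , _ , _) zero zero = p
  entry-cong (_ , p , _ , _) zero (suc s) = p
  entry-cong (_ , _ , p , _) (suc r) zero = p
  entry-cong (_ , _ , _ , p) (suc r) (suc s) = p

  entry-0₂ : ∀ r s → entry 0₂ r s ≡ 0#
  entry-0₂ zero zero = ≡.refl
  entry-0₂ zero (suc s) = ≡.refl
  entry-0₂ (suc r) zero = ≡.refl
  entry-0₂ (suc r) (suc s) = ≡.refl

  private
    if-≈ : ∀ b {x y} → x ≈ y → (if b then x else 0#) ≈ (if b then y else 0#)
    if-≈ true x≈y = x≈y
    if-≈ false _ = refl

    if-zero : ∀ b → (if b then 0# else 0#) ≡ 0#
    if-zero true = ≡.refl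
    if-zero false = ≡.refl

    if-plus : ∀ b x y → (if b then x else 0#) + (if b then y else 0#) ≈ (if b then x + y else 0#)
    if-plus true x y = refl
    if-plus false x y = +-identityʳ 0#

    if-minus : ∀ b x y → (if b then x else 0#) - (if b then y else 0#) ≈ (if b then x - y else 0#)
    if-minus true x y = refl
    if-minus false x y = -‿inverseʳ 0#

    if-*-if : ∀ p q x₀ y₀ x₁ y₁ →
      (if p then x₀ else 0#) * (if q then y₀ else 0#) + (if p then x₁ else 0#) * (if q then y₁ else 0#)
        ≈ (if p then (if q then x₀ * y₀ + x₁ * y₁ else 0#) else 0#)
    if-*-if true true x₀ y₀ x₁ y₁ = refl
    if-*-if true false x₀ y₀ x₁ y₁ = trans (+-cong (zeroʳ x₀) (zeroʳ x₁)) (+-identityʳ 0#)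
    if-*-if false q x₀ y₀ x₁ y₁ = trans (+-cong (zeroˡ _) (zeroˡ _)) (+-identityʳ 0#)

    if-≡ᵇ-≈ : ∀ {m n x y} → (m ≡ n → x ≈ y) → (if m ≡ᵇ n then x else 0#) ≈ (if m ≡ᵇ n then y else 0#)
    if-≡ᵇ-≈ {m} {n} x≈y with m ≡ᵇ n in eq
    ... | true = x≈y (≡ᵇ-true⇒≡ eq)
    ... | false = refl

    if-vanish : ∀ {m n x} → (m ≡ n → x ≈ 0#) → (if m ≡ᵇ n then x else 0#) ≈ 0#
    if-vanish {m} {n} x≈0 = trans (if-≡ᵇ-≈ x≈0) (reflexive (if-zero (m ≡ᵇ n)))

  ⊕-scal-0# : ∀ {n} (A : Mat n) → (A ⊕ scal 0#) ≋ A
  ⊕-scal-0# A a b = trans (+-congˡ (reflexive (if-zero _))) (+-identityʳ _)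

  ⊝-scal-0# : ∀ {n} (A : Mat n) → (A ⊝ scal 0#) ≋ A
  ⊝-scal-0# A a b = trans (+-congˡ (trans (-‿cong (reflexive (if-zero _))) -0#≈0#)) (+-identityʳ _)

  blockDiag : (ℕ → M₂) → ℕ → ℕ → Carrier
  blockDiag F = diag2 (λ m → entry (F m))

  blockDiag-at : ∀ F x y {m n r s} → x / 2 ≡ m → x % 2 ≡ r → y / 2 ≡ n → y % 2 ≡ s →
                 blockDiag F x y ≡ (if m ≡ᵇ n then entry (F m) r s else 0#)
  blockDiag-at F x y ≡.refl ≡.refl ≡.refl ≡.refl = ≡.refl

  blockDiag-cong : ∀ {F G} → (∀ m → F m ≈₂ G m) → ∀ x y → blockDiag F x y ≈ blockDiag G x y
  blockDiag-cong F≈G x y = if-≈ (x / 2 ≡ᵇ y / 2) (entry-cong (F≈G (x / 2)) (x % 2) (y % 2))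

  blockDiag-plus : ∀ F G x y → blockDiag F x y + blockDiag G x y ≈ blockDiag (λ m → F m +₂ G m) x y
  blockDiag-plus F G x y = trans (if-plus (x / 2 ≡ᵇ y / 2) _ _)
    (reflexive (≡.cong (λ z → if x / 2 ≡ᵇ y / 2 then z else 0#) (entry-plus₂ (F (x / 2)) (G (x / 2)) (x % 2) (y % 2))))

  blockDiag-minus : ∀ F G x y → blockDiag F x y - blockDiag G x y ≈ blockDiag (λ m → F m -₂ G m) x y
  blockDiag-minus F G x y = trans (if-minus (x / 2 ≡ᵇ y / 2) _ _)
    (reflexive (≡.cong (λ z → if x / 2 ≡ᵇ y / 2 then z else 0#) (entry-minus₂ (F (x / 2)) (G (x / 2)) (x % 2) (y % 2))))

  blockDiag-0₂ : ∀ x y → blockDiag (λ _ → 0₂) x y ≡ 0#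
  blockDiag-0₂ x y = ≡.trans (≡.cong (λ z → if x / 2 ≡ᵇ y / 2 then z else 0#) (entry-0₂ (x % 2) (y % 2))) (if-zero _)

  blockDiag-parity : ∀ F {x y} (p : ParityView x) (q : ParityView y) →
    blockDiag F x y ≡ (if block p ≡ᵇ block q then entry (F (block p)) (slot p) (slot q) else 0#)
  blockDiag-parity F {x} {y} p q = blockDiag-at F x y (/2≡block p) (%2≡slot p) (/2≡block q) (%2≡slot q)

  blockDiag-scalar : ∀ α x y → blockDiag (λ _ → scalar₂ α) x y ≡ (if x ≡ᵇ y then α else 0#)
  blockDiag-scalar α x y = ≡.trans (blockDiag-parity (λ _ → scalar₂ α) p q) (by-parity p q)
    where
    p = parityView x
    q = parityView y
    by-parity : ∀ {x y} (p : ParityView x) (q : ParityView y) →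
      (if block p ≡ᵇ block q then entry (scalar₂ α) (slot p) (slot q) else 0#) ≡ (if x ≡ᵇ y then α else 0#)
    by-parity (even m) (even n) = ≡.cong (λ b → if b then α else 0#) (≡.sym (m*2≡ᵇn*2 m n))
    by-parity (even m) (odd n) = ≡.trans (if-zero _) (≡.cong (λ b → if b then α else 0#) (≡.sym (m*2≢ᵇ1+n*2 m n)))
    by-parity (odd m) (even n) = ≡.trans (if-zero _) (≡.cong (λ b → if b then α else 0#) (≡.sym (1+m*2≢ᵇn*2 m n)))
    by-parity (odd m) (odd n) = ≡.cong (λ b → if b then α else 0#) (≡.sym (m*2≡ᵇn*2 m n))

  blockDiag-corner-shift : ∀ (μ : ℕ → Carrier) x y →
    blockDiag (λ m → corner₀₀ (μ m)) x y ≡ blockDiag (λ m → corner₁₁ (μ m)) (suc x) (suc y)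
  blockDiag-corner-shift μ x y = ≡.trans (blockDiag-parity (λ m → corner₀₀ (μ m)) p q)
    (≡.trans (by-parity p q) (≡.sym (blockDiag-parity (λ m → corner₁₁ (μ m)) (nextParity p) (nextParity q))))
    where
    p = parityView x
    q = parityView y
    by-parity : ∀ {x y} (p : ParityView x) (q : ParityView y) →
      (if block p ≡ᵇ block q then entry (corner₀₀ (μ (block p))) (slot p) (slot q) else 0#)
        ≡ (if block (nextParity p) ≡ᵇ block (nextParity q)
           then entry (corner₁₁ (μ (block (nextParity p)))) (slot (nextParity p)) (slot (nextParity q)) else 0#)
    by-parity (even m) (even n) = ≡.refl
    by-parity (even m) (odd n) = ≡.trans (if-zero _) (≡.sym (if-zero _))
    by-parity (odd m) (even n) = ≡.trans (if-zero _) (≡.sym (if-zero _))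
    by-parity (odd m) (odd n) = ≡.trans (if-zero _) (≡.sym (if-zero _))

  sumℕ-blockDiag : ∀ n F G x y → x / 2 ℕ.< n →
    sumℕ (n ℕ.* 2) (λ j → blockDiag F x j * blockDiag G j y) ≈ blockDiag (λ m → F m *₂ G m) x y
  sumℕ-blockDiag n F G x y x/2<n = begin
    sumℕ (n ℕ.* 2) (λ j → blockDiag F x j * blockDiag G j y)
      ≈⟨ sumℕ-pairs n _ ⟩
    sumℕ n (λ m → blockDiag F x (m ℕ.* 2) * blockDiag G (m ℕ.* 2) y
                  + blockDiag F x (suc (m ℕ.* 2)) * blockDiag G (suc (m ℕ.* 2)) y)
      ≈⟨ sumℕ-cong n pair ⟩
    sumℕ n (λ m → if x / 2 ≡ᵇ m then h m else 0#)
      ≈⟨ sumℕ-select h x/2<n ⟩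
    h (x / 2)
      ≡⟨ ≡.cong (λ z → if x / 2 ≡ᵇ y / 2 then z else 0#) (entry-times₂ (F (x / 2)) (G (x / 2)) (x % 2) (y % 2)) ⟩
    blockDiag (λ m → F m *₂ G m) x y ∎
    where
    open ≈-Reasoning
    h : ℕ → Carrier
    h m = if m ≡ᵇ y / 2
          then entry (F (x / 2)) (x % 2) 0 * entry (G m) 0 (y % 2) + entry (F (x / 2)) (x % 2) 1 * entry (G m) 1 (y % 2)
          else 0#
    pair : ∀ m → blockDiag F x (m ℕ.* 2) * blockDiag G (m ℕ.* 2) y
                 + blockDiag F x (suc (m ℕ.* 2)) * blockDiag G (suc (m ℕ.* 2)) y
               ≈ (if x / 2 ≡ᵇ m then h m else 0#)
    pair m = begin
      blockDiag F x (m ℕ.* 2) * blockDiag G (m ℕ.* 2) y + blockDiag F x (suc (m ℕ.* 2)) * blockDiag G (suc (m ℕ.* 2)) y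
        ≡⟨ ≡.cong₂ _+_ (≡.cong₂ _*_ (column (even m)) (row (even m))) (≡.cong₂ _*_ (column (odd m)) (row (odd m))) ⟩
      _ ≈⟨ if-*-if (x / 2 ≡ᵇ m) (m ≡ᵇ y / 2) _ _ _ _ ⟩
      (if x / 2 ≡ᵇ m then h m else 0#) ∎
      where
      column : ∀ {j} (p : ParityView j) → blockDiag F x j ≡ (if x / 2 ≡ᵇ block p then entry (F (x / 2)) (x % 2) (slot p) else 0#)
      column {j} p = blockDiag-at F x j ≡.refl ≡.refl (/2≡block p) (%2≡slot p)
      row : ∀ {j} (p : ParityView j) → blockDiag G j y ≡ (if block p ≡ᵇ y / 2 then entry (G (block p)) (slot p) (y % 2) else 0#)
      row {j} p = blockDiag-at G j y (/2≡block p) (%2≡slot p) ≡.refl ≡.refl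

  open IntegerRingSolver K using (Polynomial; solve; _:=_; _:+_; _:*_; _:-_; :-_; :0; :1)

  Quadratic : Carrier → Carrier → M₂ → Set ℓ
  Quadratic α β A = (A -₂ scalar₂ α) *₂ (A +₂ scalar₂ β) ≈₂ 0₂

  private
    module Identities₂ {n : ℕ} (a b c d α β : Polynomial n) where
      q₀₀ q₀₁ q₁₀ q₁₁ τ δ : Polynomial n
      q₀₀ = (a :- α) :* (a :+ β) :+ (b :- :0) :* (c :+ :0)
      q₀₁ = (a :- α) :* (b :+ :0) :+ (b :- :0) :* (d :+ β)
      q₁₀ = (c :- :0) :* (a :+ β) :+ (d :- α) :* (c :+ :0)
      q₁₁ = (c :- :0) :* (b :+ :0) :+ (d :- α) :* (d :+ β)
      τ = (a :+ d) :- (α :- β)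
      δ = (a :* d :- b :* c) :+ α :* β

      cayley₀₀ cayley₀₁ cayley₁₀ cayley₁₁ : Polynomial n × Polynomial n
      cayley₀₀ = q₀₀ := a :* τ :- :1 :* δ
      cayley₀₁ = q₀₁ := b :* τ :- :0 :* δ
      cayley₁₀ = q₁₀ := c :* τ :- :0 :* δ
      cayley₁₁ = q₁₁ := d :* τ :- :1 :* δ

      inverseʳ₀₀ inverseʳ₀₁ inverseʳ₁₀ inverseʳ₁₁ : Polynomial n × Polynomial n
      inverseʳ₀₀ = a :* ((a :- α) :+ β) :+ b :* ((c :- :0) :+ :0) := q₀₀ :+ α :* β
      inverseʳ₀₁ = a :* ((b :- :0) :+ :0) :+ b :* ((d :- α) :+ β) := q₀₁
      inverseʳ₁₀ = c :* ((a :- α) :+ β) :+ d :* ((c :- :0) :+ :0) := q₁₀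
      inverseʳ₁₁ = c :* ((b :- :0) :+ :0) :+ d :* ((d :- α) :+ β) := q₁₁ :+ α :* β

      inverseˡ₀₀ inverseˡ₀₁ inverseˡ₁₀ inverseˡ₁₁ : Polynomial n × Polynomial n
      inverseˡ₀₀ = ((a :- α) :+ β) :* a :+ ((b :- :0) :+ :0) :* c := q₀₀ :+ α :* β
      inverseˡ₀₁ = ((a :- α) :+ β) :* b :+ ((b :- :0) :+ :0) :* d := q₀₁
      inverseˡ₁₀ = ((c :- :0) :+ :0) :* a :+ ((d :- α) :+ β) :* c := q₁₀
      inverseˡ₁₁ = ((c :- :0) :+ :0) :* b :+ ((d :- α) :+ β) :* d := q₁₁ :+ α :* β
  open Identities₂

  cayley-hamilton : ∀ {α β} A → trace A ≈ α - β → det A ≈ - (α * β) → Quadratic α β A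
  cayley-hamilton {α} {β} (mat₂ a b c d) tr≈ det≈ =
      vanish a 1# (solve 6 cayley₀₀ refl a b c d α β)
    , vanish b 0# (solve 6 cayley₀₁ refl a b c d α β)
    , vanish c 0# (solve 6 cayley₁₀ refl a b c d α β)
    , vanish d 1# (solve 6 cayley₁₁ refl a b c d α β)
    where
    τ≈0 : (a + d) - (α - β) ≈ 0#
    τ≈0 = trans (+-congʳ tr≈) (-‿inverseʳ _)
    δ≈0 : (a * d - b * c) + α * β ≈ 0#
    δ≈0 = trans (+-congʳ det≈) (-‿inverseˡ _)
    vanish : ∀ {x} y z → x ≈ y * ((a + d) - (α - β)) - z * ((a * d - b * c) + α * β) → x ≈ 0#
    vanish y z x≈ = trans x≈ (trans (+-cong (trans (*-congˡ τ≈0) (zeroʳ y)) (-‿cong (trans (*-congˡ δ≈0) (zeroʳ z))))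
      (trans (+-congˡ -0#≈0#) (+-identityʳ 0#)))

  quadratic-inverse : ∀ {α β} A → Quadratic α β A → α * β ≈ 1# →
    let A⁻¹ = (A -₂ scalar₂ α) +₂ scalar₂ β in A *₂ A⁻¹ ≈₂ 1₂ × A⁻¹ *₂ A ≈₂ 1₂
  quadratic-inverse {α} {β} (mat₂ a b c d) (q₀₀≈0 , q₀₁≈0 , q₁₀≈0 , q₁₁≈0) αβ≈1 =
      ( isOne q₀₀≈0 (solve 6 inverseʳ₀₀ refl a b c d α β)
      , isZero q₀₁≈0 (solve 6 inverseʳ₀₁ refl a b c d α β)
      , isZero q₁₀≈0 (solve 6 inverseʳ₁₀ refl a b c d α β)
      , isOne q₁₁≈0 (solve 6 inverseʳ₁₁ refl a b c d α β) )
    , ( isOne q₀₀≈0 (solve 6 inverseˡ₀₀ refl a b c d α β)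
      , isZero q₀₁≈0 (solve 6 inverseˡ₀₁ refl a b c d α β)
      , isZero q₁₀≈0 (solve 6 inverseˡ₁₀ refl a b c d α β)
      , isOne q₁₁≈0 (solve 6 inverseˡ₁₁ refl a b c d α β) )
    where
    isZero : ∀ {x q} → q ≈ 0# → x ≈ q → x ≈ 0#
    isZero q≈0 x≈q = trans x≈q q≈0
    isOne : ∀ {x q} → q ≈ 0# → x ≈ q + α * β → x ≈ 1#
    isOne q≈0 x≈ = trans x≈ (trans (+-cong q≈0 αβ≈1) (+-identityˡ 1#))

  module BlockDiagonalMatrices (D : ℕ) where
    import Data.Nat.Properties as ℕ
    import Data.Fin.Properties as Fin
    open import Data.Nat.DivMod using (m<n*o⇒m/o<n)

    -- With offset s, block m occupies the indices 2m - s and 2m + 1 - s.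
    record BlockDiagonal (s : ℕ) (A : Mat (2 ℕ.* D)) (F : ℕ → M₂) : Set ℓ where
      constructor blocks
      field entries : ∀ a b → A a b ≈ blockDiag F (s ℕ.+ toℕ a) (s ℕ.+ toℕ b)
    open BlockDiagonal

    -- With offset 1, block 0 sticks out of the index range at -1 and block D at 2D.
    -- Products are still computed blockwise if the left factor does not map the
    -- visible rows of these two blocks to their invisible columns.
    record EdgeConfined (F : ℕ → M₂) : Set ℓ where
      constructor edgeConfined
      field
        first-block : m₁₀ (F 0) ≈ 0#
        last-block : m₀₁ (F D) ≈ 0#

    blockDiagonal-cong : ∀ {s A F G} → BlockDiagonal s A F → (∀ m → F m ≈₂ G m) → BlockDiagonal s A G
    blockDiagonal-cong {s} (blocks A~F) F≈G =
      blocks λ a b → trans (A~F a b) (blockDiag-cong F≈G (s ℕ.+ toℕ a) (s ℕ.+ toℕ b))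

    blockDiagonal-≋ : ∀ {s A B F G} → BlockDiagonal s A F → BlockDiagonal s B G → (∀ m → F m ≈₂ G m) → A ≋ B
    blockDiagonal-≋ A~F (blocks B~G) F≈G a b = trans (entries (blockDiagonal-cong A~F F≈G) a b) (sym (B~G a b))

    ⊕-blockDiagonal : ∀ {s A B F G} → BlockDiagonal s A F → BlockDiagonal s B G →
                      BlockDiagonal s (A ⊕ B) (λ m → F m +₂ G m)
    ⊕-blockDiagonal {s} {F = F} {G} (blocks A~F) (blocks B~G) =
      blocks λ a b → trans (+-cong (A~F a b) (B~G a b)) (blockDiag-plus F G (s ℕ.+ toℕ a) (s ℕ.+ toℕ b))

    ⊝-blockDiagonal : ∀ {s A B F G} → BlockDiagonal s A F → BlockDiagonal s B G →
                      BlockDiagonal s (A ⊝ B) (λ m → F m -₂ G m)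
    ⊝-blockDiagonal {s} {F = F} {G} (blocks A~F) (blocks B~G) =
      blocks λ a b → trans (+-cong (A~F a b) (-‿cong (B~G a b))) (blockDiag-minus F G (s ℕ.+ toℕ a) (s ℕ.+ toℕ b))

    zeroM-blockDiagonal : ∀ s → BlockDiagonal s zeroM (λ _ → 0₂)
    zeroM-blockDiagonal s = blocks λ a b → reflexive (≡.sym (blockDiag-0₂ (s ℕ.+ toℕ a) (s ℕ.+ toℕ b)))

    scal-blockDiagonal : ∀ s α → BlockDiagonal s (scal α) (λ _ → scalar₂ α)
    scal-blockDiagonal s α = blocks λ a b → reflexive (≡.sym (≡.trans (blockDiag-scalar α (s ℕ.+ toℕ a) (s ℕ.+ toℕ b))
      (≡.cong (λ c → if c then α else 0#) (+-≡ᵇ s (toℕ a) (toℕ b)))))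
      where
      +-≡ᵇ : ∀ s x y → (s ℕ.+ x ≡ᵇ s ℕ.+ y) ≡ (x ≡ᵇ y)
      +-≡ᵇ zero x y = ≡.refl
      +-≡ᵇ (suc s) x y = +-≡ᵇ s x y

    private
      toℕ<D*2 : ∀ (a : Fin (2 ℕ.* D)) → toℕ a ℕ.< D ℕ.* 2
      toℕ<D*2 a = ≡.subst (toℕ a ℕ.<_) (ℕ.*-comm 2 D) (Fin.toℕ<n a)

      sumFin-shift : ∀ s (g : ℕ → Carrier) → sumFin (2 ℕ.* D) (λ k → g (s ℕ.+ toℕ k)) ≡ sumℕ (D ℕ.* 2) (λ k → g (s ℕ.+ k))
      sumFin-shift s g = ≡.trans (sumFin≡sumℕ (2 ℕ.* D) (λ k → g (s ℕ.+ k))) (≡.cong (λ n → sumℕ n (λ k → g (s ℕ.+ k))) (ℕ.*-comm 2 D))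

    Multiplies : ℕ → (ℕ → M₂) → Set (c ⊔ ℓ)
    Multiplies s F = ∀ {A B G} → BlockDiagonal s A F → BlockDiagonal s B G → BlockDiagonal s (A ⊗ B) (λ m → F m *₂ G m)

    ⊗-blockDiagonal₀ : ∀ F → Multiplies 0 F
    ⊗-blockDiagonal₀ F {A} {B} {G} (blocks A~F) (blocks B~G) = blocks λ a b →
      let g : ℕ → Carrier
          g j = blockDiag F (toℕ a) j * blockDiag G j (toℕ b)
      in begin
      sumFin (2 ℕ.* D) (λ k → A a k * B k b)         ≈⟨ sumFin-cong (2 ℕ.* D) (λ k → *-cong (A~F a k) (B~G k b)) ⟩
      sumFin (2 ℕ.* D) (λ k → g (toℕ k))             ≡⟨ sumFin-shift 0 g ⟩
      sumℕ (D ℕ.* 2) g                                ≈⟨ sumℕ-blockDiag D F G (toℕ a) (toℕ b) (m<n*o⇒m/o<n (toℕ<D*2 a)) ⟩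
      blockDiag (λ m → F m *₂ G m) (toℕ a) (toℕ b)    ∎
      where open ≈-Reasoning

    ⊗-blockDiagonal₁ : ∀ {F} → EdgeConfined F → Multiplies 1 F
    ⊗-blockDiagonal₁ {F} (edgeConfined F₀-confined F_D-confined) {A} {B} {G} (blocks A~F) (blocks B~G) = blocks entry≈
      where
      open ≈-Reasoning
      entry≈ : ∀ a b → (A ⊗ B) a b ≈ blockDiag (λ m → F m *₂ G m) (suc (toℕ a)) (suc (toℕ b))
      entry≈ a b = begin
        sumFin (2 ℕ.* D) (λ k → A a k * B k b)                  ≈⟨ sumFin-cong (2 ℕ.* D) (λ k → *-cong (A~F a k) (B~G k b)) ⟩
        sumFin (2 ℕ.* D) (λ k → g (suc (toℕ k)))                ≡⟨ sumFin-shift 1 g ⟩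
        sumℕ (D ℕ.* 2) (λ k → g (suc k))                         ≈⟨ +-identityʳ _ ⟨
        sumℕ (D ℕ.* 2) (λ k → g (suc k)) + 0#                    ≈⟨ +-congˡ g-last ⟨
        sumℕ (D ℕ.* 2) (λ k → g (suc k)) + g (suc (D ℕ.* 2))     ≈⟨ sumℕ-snoc (D ℕ.* 2) (λ k → g (suc k)) ⟨
        sumℕ (suc (D ℕ.* 2)) (λ k → g (suc k))                   ≈⟨ +-identityˡ _ ⟨
        0# + sumℕ (suc (D ℕ.* 2)) (λ k → g (suc k))              ≈⟨ +-congʳ g-first ⟨
        sumℕ (suc D ℕ.* 2) g                                     ≈⟨ sumℕ-blockDiag (suc D) F G x y x/2<1+D ⟩
        blockDiag (λ m → F m *₂ G m) x y                         ∎
        where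
        x y : ℕ
        x = suc (toℕ a)
        y = suc (toℕ b)
        x≤D*2 : x ℕ.≤ D ℕ.* 2
        x≤D*2 = toℕ<D*2 a
        x/2<1+D : x / 2 ℕ.< suc D
        x/2<1+D = m<n*o⇒m/o<n (ℕ.s≤s (ℕ.m≤n⇒m≤1+n x≤D*2))
        g : ℕ → Carrier
        g j = blockDiag F x j * blockDiag G j y
        last-column : blockDiag F x (suc (D ℕ.* 2)) ≡ (if x / 2 ≡ᵇ D then entry (F (x / 2)) (x % 2) 1 else 0#)
        last-column = blockDiag-at F x (suc (D ℕ.* 2)) ≡.refl ≡.refl (/2≡block (odd D)) (%2≡slot (odd D))
        g-first : g 0 ≈ 0#
        g-first = trans (*-congʳ (if-vanish λ x/2≡0 →
            trans (reflexive (≡.cong₂ (λ m r → entry (F m) r 0) x/2≡0 ([1+n]/2≡0⇒[1+n]%2≡1 (toℕ a) x/2≡0))) F₀-confined))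
          (zeroˡ _)
        g-last : g (suc (D ℕ.* 2)) ≈ 0#
        g-last = trans (*-congʳ (trans (reflexive last-column)
            (if-vanish λ x/2≡D →
              trans (reflexive (≡.cong₂ (λ m r → entry (F m) r 1) x/2≡D (n/2≡m⇒n%2≡0 x≤D*2 x/2≡D))) F_D-confined)))
          (zeroˡ _)

    corner-shift-blockDiagonal : ∀ {A} (μ : ℕ → Carrier) → BlockDiagonal 0 A (λ m → corner₀₀ (μ m)) →
                                 BlockDiagonal 1 A (λ m → corner₁₁ (μ m))
    corner-shift-blockDiagonal μ (blocks A~μ) =
      blocks λ a b → trans (A~μ a b) (reflexive (blockDiag-corner-shift μ (toℕ a) (toℕ b)))

    diag121-blockDiagonal : ∀ {x₀ x_D} F → x₀ ≈ m₁₁ (F 0) → x_D ≈ m₀₀ (F D) →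
                            BlockDiagonal 1 (toMat D (diag121 D x₀ x_D (λ m → entry (F m)))) F
    diag121-blockDiagonal {x₀} {x_D} F x₀≈ x_D≈ = blocks λ a b → if-≡ᵇ-≈ (inner a b)
      where
      entry-at : ∀ {m m' r r' s s'} → m ≡ m' → r ≡ r' → s ≡ s' → entry (F m) r s ≡ entry (F m') r' s'
      entry-at ≡.refl ≡.refl ≡.refl = ≡.refl
      inner : ∀ (a b : Fin (2 ℕ.* D)) → let x = suc (toℕ a) ; y = suc (toℕ b) in x / 2 ≡ y / 2 →
        (if x / 2 ≡ᵇ 0 then x₀ else if x / 2 ≡ᵇ D then x_D else entry (F (x / 2)) (x % 2) (y % 2))
          ≈ entry (F (x / 2)) (x % 2) (y % 2)
      inner a b x/2≡y/2 with suc (toℕ a) / 2 ≡ᵇ 0 in x/2≡ᵇ0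
      ... | true = trans x₀≈ (reflexive (≡.sym (entry-at x/2≡0
                   ([1+n]/2≡0⇒[1+n]%2≡1 (toℕ a) x/2≡0) ([1+n]/2≡0⇒[1+n]%2≡1 (toℕ b) (≡.trans (≡.sym x/2≡y/2) x/2≡0)))))
        where x/2≡0 = ≡ᵇ-true⇒≡ x/2≡ᵇ0
      ... | false with suc (toℕ a) / 2 ≡ᵇ D in x/2≡ᵇD
      ...   | true = trans x_D≈ (reflexive (≡.sym (entry-at x/2≡D
                   (n/2≡m⇒n%2≡0 (toℕ<D*2 a) x/2≡D) (n/2≡m⇒n%2≡0 (toℕ<D*2 b) (≡.trans (≡.sym x/2≡y/2) x/2≡D)))))
        where x/2≡D = ≡ᵇ-true⇒≡ x/2≡ᵇD
      ...   | false = refl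

    edgeConfined-plus₂ : ∀ {F G} → EdgeConfined F → EdgeConfined G → EdgeConfined (λ m → F m +₂ G m)
    edgeConfined-plus₂ (edgeConfined f₀ f_D) (edgeConfined g₀ g_D) =
      edgeConfined (trans (+-cong f₀ g₀) (+-identityʳ 0#)) (trans (+-cong f_D g_D) (+-identityʳ 0#))

    edgeConfined-minus₂ : ∀ {F G} → EdgeConfined F → EdgeConfined G → EdgeConfined (λ m → F m -₂ G m)
    edgeConfined-minus₂ (edgeConfined f₀ f_D) (edgeConfined g₀ g_D) =
      edgeConfined (trans (+-cong f₀ (-‿cong g₀)) (-‿inverseʳ 0#)) (trans (+-cong f_D (-‿cong g_D)) (-‿inverseʳ 0#))

    edgeConfined-scalar₂ : ∀ α → EdgeConfined (λ _ → scalar₂ α)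
    edgeConfined-scalar₂ α = edgeConfined refl refl

    quadratic-relation : ∀ {s A F α β} → BlockDiagonal s A F → Multiplies s (λ m → F m -₂ scalar₂ α) →
      (∀ m → Quadratic α β (F m)) → ((A ⊝ scal α) ⊗ (A ⊕ scal β)) ≋ zeroM
    quadratic-relation {s} {α = α} {β} A~F multiplies quadratic = blockDiagonal-≋
      (multiplies (⊝-blockDiagonal A~F (scal-blockDiagonal s α)) (⊕-blockDiagonal A~F (scal-blockDiagonal s β)))
      (zeroM-blockDiagonal s) quadratic

    quadratic-inverses : ∀ {s A F α β} → BlockDiagonal s A F →
      Multiplies s F → Multiplies s (λ m → (F m -₂ scalar₂ α) +₂ scalar₂ β) →
      (∀ m → Quadratic α β (F m)) → α * β ≈ 1# → Inverses A ((A ⊝ scal α) ⊕ scal β)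
    quadratic-inverses {s} {F = F} {α} {β} A~F F-multiplies F⁻¹-multiplies quadratic αβ≈1 =
        blockDiagonal-≋ (F-multiplies A~F A⁻¹~F⁻¹) (scal-blockDiagonal s 1#)
          (λ m → proj₁ (quadratic-inverse (F m) (quadratic m) αβ≈1))
      , blockDiagonal-≋ (F⁻¹-multiplies A⁻¹~F⁻¹ A~F) (scal-blockDiagonal s 1#)
          (λ m → proj₂ (quadratic-inverse (F m) (quadratic m) αβ≈1))
      where
      A⁻¹~F⁻¹ = ⊕-blockDiagonal (⊝-blockDiagonal A~F (scal-blockDiagonal s α)) (scal-blockDiagonal s β)

  module QPowers (ρρ⁻¹≈1 : ρ * ρ⁻¹ ≈ 1#) where
    open import Data.Integer as ℤ using (ℤ; +_; -[1+_]; _⊖_)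
    import Data.Integer.Properties as ℤ
    import Data.Nat.Properties as ℕ
    open import Algebra.Properties.CommutativeSemigroup *-commutativeSemigroup using (interchange)
    open ≈-Reasoning

    pow-+ : ∀ x m n → pow x (m ℕ.+ n) ≈ pow x m * pow x n
    pow-+ x zero n = sym (*-identityˡ _)
    pow-+ x (suc m) n = trans (*-congˡ (pow-+ x m n)) (sym (*-assoc _ _ _))

    qq-⊖ : ∀ m n → qq (m ⊖ n) ≈ pow ρ m * pow ρ⁻¹ n
    qq-⊖ m zero = sym (*-identityʳ _)
    qq-⊖ zero (suc n) = sym (*-identityˡ _)
    qq-⊖ (suc m) (suc n) = begin
      qq (suc m ⊖ suc n)                      ≡⟨ ≡.cong qq (ℤ.[1+m]⊖[1+n]≡m⊖n m n) ⟩
      qq (m ⊖ n)                              ≈⟨ qq-⊖ m n ⟩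
      pow ρ m * pow ρ⁻¹ n                     ≈⟨ *-identityˡ _ ⟨
      1# * (pow ρ m * pow ρ⁻¹ n)              ≈⟨ *-congʳ ρρ⁻¹≈1 ⟨
      (ρ * ρ⁻¹) * (pow ρ m * pow ρ⁻¹ n)       ≈⟨ interchange ρ ρ⁻¹ (pow ρ m) (pow ρ⁻¹ n) ⟩
      pow ρ (suc m) * pow ρ⁻¹ (suc n)         ∎

    qq-+ : ∀ x y → qq (x ℤ.+ y) ≈ qq x * qq y
    qq-+ (+ m) (+ n) = pow-+ ρ m n
    qq-+ (+ m) -[1+ n ] = qq-⊖ m (suc n)
    qq-+ -[1+ m ] (+ n) = trans (qq-⊖ n (suc m)) (*-comm _ _)
    qq-+ -[1+ m ] -[1+ n ] = begin
      pow ρ⁻¹ (suc (suc (m ℕ.+ n)))           ≡⟨ ≡.cong (λ k → pow ρ⁻¹ (suc k)) (ℕ.+-suc m n) ⟨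
      pow ρ⁻¹ (suc m ℕ.+ suc n)               ≈⟨ pow-+ ρ⁻¹ (suc m) (suc n) ⟩
      pow ρ⁻¹ (suc m) * pow ρ⁻¹ (suc n)       ∎

    qq-collapse : ∀ x y {w} → x ℤ.+ y ≡ w → qq x * qq y ≈ qq w
    qq-collapse x y ≡.refl = sym (qq-+ x y)

  module Construction (D E : ℕ) (i²≈-1 : i * i ≈ - 1#) (ρρ⁻¹≈1 : ρ * ρ⁻¹ ≈ 1#) where
    open import Data.Integer as ℤ using (ℤ; +_)
    import Data.Integer.Properties as ℤ
    open import Data.Integer.Tactic.RingSolver using (solve-∀)
    import Data.Nat.Properties as ℕ
    open BlockDiagonalMatrices D
    open QPowers ρρ⁻¹≈1
    open ≈-Reasoning

    -- qq w stands for q^(w/4): X = q^(D/2), Y = q^(-D/2), s k = q^(k-D/2), r k = q^(D/2-k).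
    h f e : ℤ
    h = z (2 ℕ.* D)
    f = z (4 ℕ.* D)
    e = z E

    n : ℕ → ℤ
    n k = z (4 ℕ.* k)

    f≡h+h : f ≡ h ℤ.+ h
    f≡h+h = ≡.trans (≡.cong +_ (ℕ.*-distribʳ-+ D 2 2)) (ℤ.pos-+ (2 ℕ.* D) (2 ℕ.* D))

    X Y : Carrier
    X = qq h
    Y = qq (ℤ.- h)

    s r : ℕ → Carrier
    s k = qq (n k ℤ.- h)
    r k = qq (h ℤ.- n k)

    Y*X≈1 : Y * X ≈ 1#
    Y*X≈1 = qq-collapse (ℤ.- h) h (ℤ.+-inverseˡ h)

    Y*q^f≈X : Y * qq f ≈ X
    Y*q^f≈X = qq-collapse (ℤ.- h) f (≡.trans (≡.cong (λ w → ℤ.- h ℤ.+ w) f≡h+h) (exponent h))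
      where
      exponent : ∀ a → ℤ.- a ℤ.+ (a ℤ.+ a) ≡ a
      exponent = solve-∀

    Y*q^n≈s : ∀ k → Y * qq (n k) ≈ s k
    Y*q^n≈s k = qq-collapse (ℤ.- h) (n k) (ℤ.+-comm (ℤ.- h) (n k))

    X*q^[n-f]≈s : ∀ k → X * qq (n k ℤ.- f) ≈ s k
    X*q^[n-f]≈s k = qq-collapse h (n k ℤ.- f) (≡.trans (≡.cong (λ w → h ℤ.+ (n k ℤ.- w)) f≡h+h) (exponent h (n k)))
      where
      exponent : ∀ a b → a ℤ.+ (b ℤ.- (a ℤ.+ a)) ≡ b ℤ.- a
      exponent = solve-∀

    s*r≈1 : ∀ k → s k * r k ≈ 1#
    s*r≈1 k = qq-collapse (n k ℤ.- h) (h ℤ.- n k) (exponent (n k) h)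
      where
      exponent : ∀ a b → (a ℤ.- b) ℤ.+ (b ℤ.- a) ≡ + 0
      exponent = solve-∀

    X*r≈q^[f-n] : ∀ k → X * r k ≈ qq (f ℤ.- n k)
    X*r≈q^[f-n] k = qq-collapse h (h ℤ.- n k) (≡.trans (exponent h (n k)) (≡.cong (ℤ._- n k) (≡.sym f≡h+h)))
      where
      exponent : ∀ a b → a ℤ.+ (a ℤ.- b) ≡ (a ℤ.+ a) ℤ.- b
      exponent = solve-∀

    tBlock t'Block uBlock u'Block : ℕ → M₂
    tBlock k = fromBlk (t-blk D E k)
    t'Block k = fromBlk (t'-blk D k)
    uBlock k = fromBlk (u-blk D k)
    u'Block k = fromBlk (u'-blk D E k)

    t'Normal : ℕ → M₂
    t'Normal k = mat₂ (i * ((X + Y) - s k)) (i * (s k - X)) (i * (Y - s k)) (i * s k)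

    t'Block≈t'Normal : ∀ k → t'Block k ≈₂ t'Normal k
    t'Block≈t'Normal k = *-congˡ m₀₀≈ , *-congˡ m₀₁≈ , *-congˡ m₁₀≈ , refl
      where
      m₀₀≈ : Y * ((qq f - qq (n k)) + 1#) ≈ (X + Y) - s k
      m₀₀≈ = begin
        Y * ((qq f - qq (n k)) + 1#)
          ≈⟨ solve 3 (λ Y W Q → Y :* ((W :- Q) :+ :1) := (Y :* W :- Y :* Q) :+ Y) refl Y (qq f) (qq (n k)) ⟩
        (Y * qq f - Y * qq (n k)) + Y
          ≈⟨ +-congʳ (+-cong Y*q^f≈X (-‿cong (Y*q^n≈s k))) ⟩
        (X - s k) + Y
          ≈⟨ solve 3 (λ X Y s → (X :- s) :+ Y := (X :+ Y) :- s) refl X Y (s k) ⟩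
        (X + Y) - s k
          ∎
      m₀₁≈ : X * (qq (n k ℤ.- f) - 1#) ≈ s k - X
      m₀₁≈ = begin
        X * (qq (n k ℤ.- f) - 1#)      ≈⟨ solve 2 (λ X R → X :* (R :- :1) := X :* R :- X) refl X (qq (n k ℤ.- f)) ⟩
        X * qq (n k ℤ.- f) - X         ≈⟨ +-congʳ (X*q^[n-f]≈s k) ⟩
        s k - X                        ∎
      m₁₀≈ : Y * (1# - qq (n k)) ≈ Y - s k
      m₁₀≈ = begin
        Y * (1# - qq (n k))            ≈⟨ solve 2 (λ Y Q → Y :* (:1 :- Q) := Y :- Y :* Q) refl Y (qq (n k)) ⟩
        Y - Y * qq (n k)               ≈⟨ +-congˡ (-‿cong (Y*q^n≈s k)) ⟩
        Y - s k                        ∎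

    t-blocks : BlockDiagonal 0 (𝔱 D E) tBlock
    t-blocks = blocks λ a b → refl

    u'-blocks : BlockDiagonal 0 (𝔲' D E) u'Block
    u'-blocks = blocks λ a b → refl

    -- At k = 0 and k = D the formula for t'(k) has κ' as the entry that survives in
    -- the 1 × 1 blocks of 𝔱'.
    t'-blocks : BlockDiagonal 1 (𝔱' D) t'Normal
    t'-blocks = blockDiagonal-cong (diag121-blockDiagonal t'Block first last) t'Block≈t'Normal
      where
      first : i * Y ≈ i * s 0
      first = reflexive (≡.cong (λ w → i * qq w) (≡.sym (ℤ.+-identityˡ (ℤ.- h))))
      last : i * Y ≈ i * (Y * ((qq f - qq f) + 1#))
      last = *-congˡ (sym (trans (*-congˡ (trans (+-congʳ (-‿inverseʳ (qq f))) (+-identityˡ 1#))) (*-identityʳ Y)))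

    u-blocks : BlockDiagonal 1 (𝔲 D) uBlock
    u-blocks = diag121-blockDiagonal uBlock refl refl

    t'-confined : EdgeConfined t'Normal
    t'-confined = edgeConfined (vanishes (reflexive (≡.cong qq (≡.sym (ℤ.+-identityˡ (ℤ.- h))))))
                               (vanishes (reflexive (≡.cong qq (≡.trans (≡.cong (ℤ._- h) f≡h+h) (exponent h)))))
      where
      vanishes : ∀ {x y} → x ≈ y → i * (x - y) ≈ 0#
      vanishes x≈y = trans (*-congˡ (trans (+-congʳ x≈y) (-‿inverseʳ _))) (zeroʳ i)
      exponent : ∀ a → (a ℤ.+ a) ℤ.- a ≡ a
      exponent = solve-∀

    u-confined : EdgeConfined uBlock
    u-confined = edgeConfined refl (trans (+-congˡ (-‿cong (reflexive (≡.cong qq (ℤ.+-inverseʳ f))))) (-‿inverseʳ 1#))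

    t-quadratic : ∀ k → Quadratic (κ E) (κ⁻¹ E) (tBlock k)
    t-quadratic k = cayley-hamilton (tBlock k) (+-identityʳ _)
      (solve 2 (λ a b → (a :- b) :* :0 :- b :* a := :- (a :* b)) refl (κ E) (κ⁻¹ E))

    t'-quadratic : ∀ k → Quadratic (κ' D) (κ'⁻¹ D) (t'Normal k)
    t'-quadratic k = cayley-hamilton (t'Normal k)
      (solve 4 (λ i X Y s → i :* ((X :+ Y) :- s) :+ i :* s := i :* Y :- (:- (i :* X))) refl i X Y (s k))
      (solve 4 (λ i X Y s → i :* ((X :+ Y) :- s) :* (i :* s) :- i :* (s :- X) :* (i :* (Y :- s))
                            := :- (i :* Y :* (:- (i :* X)))) refl i X Y (s k))

    u-quadratic : ∀ k → Quadratic 0# 1# (uBlock k)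
    u-quadratic k = cayley-hamilton (uBlock k) (solve 0 ((:- :1) :+ :0 := :0 :- :1) refl)
      (solve 1 (λ v → (:- :1) :* :0 :- v :* :0 := :- (:0 :* :1)) refl _)

    u'-quadratic : ∀ k → Quadratic 0# 0# (u'Block k)
    u'-quadratic k = cayley-hamilton (u'Block k) (solve 0 (:0 :+ :0 := :0 :- :0) refl)
      (solve 1 (λ w → :0 :* :0 :- :0 :* w := :- (:0 :* :0)) refl _)

    κκ⁻¹≈1 : κ E * κ⁻¹ E ≈ 1#
    κκ⁻¹≈1 = qq-collapse (ℤ.- e) e (ℤ.+-inverseˡ e)

    κ'κ'⁻¹≈1 : κ' D * κ'⁻¹ D ≈ 1#
    κ'κ'⁻¹≈1 = begin
      i * Y * - (i * X)      ≈⟨ solve 3 (λ i X Y → i :* Y :* (:- (i :* X)) := :- (i :* i :* (Y :* X))) refl i X Y ⟩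
      - (i * i * (Y * X))    ≈⟨ -‿cong (*-cong i²≈-1 Y*X≈1) ⟩
      - (- 1# * 1#)          ≈⟨ solve 0 (:- (:- :1 :* :1) := :1) refl ⟩
      1#                     ∎

    rel-T : ((𝔱 D E ⊝ scal (κ E)) ⊗ (𝔱 D E ⊕ scal (κ⁻¹ E))) ≋ zeroM
    rel-T = quadratic-relation t-blocks (⊗-blockDiagonal₀ _) t-quadratic

    rel-T' : ((𝔱' D ⊝ scal (κ' D)) ⊗ (𝔱' D ⊕ scal (κ'⁻¹ D))) ≋ zeroM
    rel-T' = quadratic-relation t'-blocks
      (⊗-blockDiagonal₁ (edgeConfined-minus₂ t'-confined (edgeConfined-scalar₂ _))) t'-quadratic

    rel-U : (𝔲 D ⊗ (𝔲 D ⊕ idM)) ≋ zeroM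
    rel-U = ≋-trans (⊗-cong (≋-sym (⊝-scal-0# (𝔲 D))) ≋-refl) (quadratic-relation u-blocks
      (⊗-blockDiagonal₁ (edgeConfined-minus₂ u-confined (edgeConfined-scalar₂ _))) u-quadratic)

    rel-U' : (𝔲' D E ⊗ 𝔲' D E) ≋ zeroM
    rel-U' = ≋-trans (⊗-cong (≋-sym (⊝-scal-0# (𝔲' D E))) (≋-sym (⊕-scal-0# (𝔲' D E))))
      (quadratic-relation u'-blocks (⊗-blockDiagonal₀ _) u'-quadratic)

    t-inverses : Inverses (𝔱 D E) ((𝔱 D E ⊝ scal (κ E)) ⊕ scal (κ⁻¹ E))
    t-inverses = quadratic-inverses t-blocks (⊗-blockDiagonal₀ _) (⊗-blockDiagonal₀ _) t-quadratic κκ⁻¹≈1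

    t'-inverses : Inverses (𝔱' D) ((𝔱' D ⊝ scal (κ' D)) ⊕ scal (κ'⁻¹ D))
    t'-inverses = quadratic-inverses t'-blocks (⊗-blockDiagonal₁ t'-confined)
      (⊗-blockDiagonal₁ (edgeConfined-plus₂ (edgeConfined-minus₂ t'-confined (edgeConfined-scalar₂ _)) (edgeConfined-scalar₂ _)))
      t'-quadratic κ'κ'⁻¹≈1

    μ : ℕ → Carrier
    μ k = - (i * r k)

    tu'-blocks : BlockDiagonal 0 (𝔱 D E ⊗ 𝔲' D E) (λ k → corner₀₀ (μ k))
    tu'-blocks = blockDiagonal-cong (⊗-blockDiagonal₀ tBlock t-blocks u'-blocks) tu'≈corner
      where
      tu'≈corner : ∀ k → tBlock k *₂ u'Block k ≈₂ corner₀₀ (μ k)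
      tu'≈corner k =
          (begin
            (κ E - κ⁻¹ E) * 0# + κ⁻¹ E * - (i * U)
              ≈⟨ solve 4 (λ a b i U → (a :- b) :* :0 :+ b :* (:- (i :* U)) := :- (i :* (b :* U))) refl (κ E) (κ⁻¹ E) i U ⟩
            - (i * (κ⁻¹ E * U))
              ≈⟨ -‿cong (*-congˡ (qq-collapse e ((h ℤ.- e) ℤ.- n k) (exponent h e (n k)))) ⟩
            - (i * r k)
              ∎)
        , solve 2 (λ a b → (a :- b) :* :0 :+ b :* :0 := :0) refl (κ E) (κ⁻¹ E)
        , solve 2 (λ a w → a :* :0 :+ :0 :* w := :0) refl (κ E) (- (i * U))
        , solve 1 (λ a → a :* :0 :+ :0 :* :0 := :0) refl (κ E)
        where
        U = qq ((h ℤ.- e) ℤ.- n k)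
        exponent : ∀ a b c → b ℤ.+ ((a ℤ.- b) ℤ.- c) ≡ a ℤ.- c
        exponent = solve-∀

    x*u'≋u+1 : ((𝔱' D ⊗ 𝔱 D E) ⊗ 𝔲' D E) ≋ (𝔲 D ⊕ idM)
    x*u'≋u+1 = ≋-trans (⊗-assoc (𝔱' D) (𝔱 D E) (𝔲' D E)) (blockDiagonal-≋
      (⊗-blockDiagonal₁ t'-confined t'-blocks (corner-shift-blockDiagonal μ tu'-blocks))
      (⊕-blockDiagonal u-blocks (scal-blockDiagonal 1 1#)) t'μ≈u+1)
      where
      t'μ≈u+1 : ∀ k → t'Normal k *₂ corner₁₁ (μ k) ≈₂ uBlock k +₂ 1₂
      t'μ≈u+1 k =
          solve 2 (λ a b → a :* :0 :+ b :* :0 := :- :1 :+ :1) refl (m₀₀ (t'Normal k)) (m₀₁ (t'Normal k))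
        , (begin
            m₀₀ (t'Normal k) * 0# + i * (s k - X) * - (i * r k)
              ≈⟨ solve 5 (λ a i s X r → a :* :0 :+ i :* (s :- X) :* (:- (i :* r)) := :- (i :* i :* (s :* r :- X :* r)))
                   refl _ i (s k) X (r k) ⟩
            - (i * i * (s k * r k - X * r k))
              ≈⟨ -‿cong (*-cong i²≈-1 (+-cong (s*r≈1 k) (-‿cong (X*r≈q^[f-n] k)))) ⟩
            - (- 1# * (1# - qq (f ℤ.- n k)))
              ≈⟨ solve 1 (λ V → :- (:- :1 :* (:1 :- V)) := (:1 :- V) :+ :0) refl _ ⟩
            (1# - qq (f ℤ.- n k)) + 0#
              ∎)
        , solve 2 (λ a b → a :* :0 :+ b :* :0 := :0 :+ :0) refl (m₁₀ (t'Normal k)) (m₁₁ (t'Normal k))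
        , (begin
            m₁₀ (t'Normal k) * 0# + i * s k * - (i * r k)
              ≈⟨ solve 4 (λ a i s r → a :* :0 :+ i :* s :* (:- (i :* r)) := :- (i :* i :* (s :* r))) refl _ i (s k) (r k) ⟩
            - (i * i * (s k * r k))
              ≈⟨ -‿cong (*-cong i²≈-1 (s*r≈1 k)) ⟩
            - (- 1# * 1#)
              ≈⟨ solve 0 (:- (:- :1 :* :1) := :0 :+ :1) refl ⟩
            0# + 1#
              ∎)

open import Data.Nat using (_≤_; _^_; _*_)
open import Data.Nat.Primality using (Prime)
open import Data.Product using (Σ; ∃; _×_)
open import Data.Sum using (_⊎_)

proposition8p7 : {c ℓ : Level} (K : CommutativeRing c ℓ)
    (i ρ ρ⁻¹ : CommutativeRing.Carrier K)
    (q D E : ℕ) →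
    (∃ λ p → ∃ λ k → Prime p × 1 ≤ k × q ≡ p ^ k) →
    3 ≤ D →
    ((E ≡ 0 ⊎ E ≡ 2 ⊎ E ≡ 4) ⊎ ((E ≡ 1 ⊎ E ≡ 3) × (∃ λ m → q ≡ m * m))) →
    CommutativeRing._≈_ K (CommutativeRing._*_ K i i) (CommutativeRing.-_ K (CommutativeRing.1# K)) →
    CommutativeRing._≈_ K (CommutativeRing._*_ K ρ ρ⁻¹) (CommutativeRing.1# K) →
    CommutativeRing._≈_ K (Setup.pow K i ρ ρ⁻¹ ρ 4) (Setup.natK K i ρ ρ⁻¹ q) →
    Setup.IsRep K i ρ ρ⁻¹ (2 * D)
      (Setup.κ K i ρ ρ⁻¹ E) (Setup.κ⁻¹ K i ρ ρ⁻¹ E)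
      (Setup.κ' K i ρ ρ⁻¹ D) (Setup.κ'⁻¹ K i ρ ρ⁻¹ D)
      (Setup.𝔱 K i ρ ρ⁻¹ D E) (Setup.𝔱' K i ρ ρ⁻¹ D)
      (Setup.𝔲 K i ρ ρ⁻¹ D) (Setup.𝔲' K i ρ ρ⁻¹ D E)
      (Setup.𝔵 K i ρ ρ⁻¹ D E)
proposition8p7 K i ρ ρ⁻¹ q D E _ _ _ i²≈-1 ρρ⁻¹≈1 _ =
  relations⇒isRep K i ρ ρ⁻¹ t-inverses t'-inverses x*u'≋u+1 rel-T rel-T' rel-U rel-U'
  where open Construction K i ρ ρ⁻¹ D E i²≈-1 ρρ⁻¹≈1
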